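{- Let $\mathbb{F}_q$ be a finite field, $P,Q\in\mathbb{F}_q[X]\setminus\{0\}$ coprime with $\deg P>\deg Q$, $\mathcal{D}=\{s\in\mathbb{F}_q[X]:\deg s<\deg P\}$, $r=q^{\deg P-\deg Q}$, and let $(b_n)_{n\ge0}$ be the enumeration of $\mathbb{F}_q[X]$ ordered lexicographically by digit strings (defined below). Then for all integers $t,m\ge0$ and all $k\in\{0,\dots,r^m-1\}$ we have $s^{(m)}(b_{r^mt+k})=s^{(0)}(b_t)$.
   Context: For $w\in\mathbb{F}_q[X]$ put $w_0=w$, and for $i\ge0$ let $s_i\in\mathcal{D}$ be the remainder of $Qw_i$ upon division by $P$ and $w_{i+1}=(Qw_i-s_i)/P$; with $k\ge0$ minimal such that $w_i=0$ for $i>k$, the digit string is $\langle w\rangle=s_k\cdots s_0$ and $w=\sum_{i=0}^k\frac{s_i}{Q}(P/Q)^i$. Set $s^{(m)}(w)=s_m$ for $m\le k$ and $s^{(m)}(w)=0$ for $m>k$. Order $\mathbb{F}_q[X]$ as follows: fix $\mathbb{F}_q=\{a_0,\dots,a_{q-1}\}$ with $a_0=0,a_1=1$, and for $n=\sum_i n_iq^i$ in base $q$ put $a_n=\sum_i a_{n_i}X^i$; declare $a_i\sqsubset a_j$ iff $i<j$. Order digit strings $s=s_k\cdots s_0$, $t=t_\ell\cdots t_0$ by: $s\sqsubset t$ if $k<\ell$, or $k=\ell$ and for the largest index $i$ with $s_i\ne t_i$ one has $s_i\sqsubset t_i$. Then $b_n$ denotes the $(n+1)$-st element of $\mathbb{F}_q[X]$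 when the polynomials $w$ are arranged increasingly according to $\langle w\rangle$ in this order. -}

module Defs where

open import Data.Nat as ℕ using (ℕ; zero; suc; _<_; _≤_; _∸_; _<?_)
open import Data.Fin using (Fin; toℕ)
import Data.Fin as Fin
open import Data.List using (List; []; _∷_; length; map; replicate; _++_)
open import Data.Product using (Σ; ∃; ∃-syntax; _×_; _,_; proj₁; proj₂)
open import Data.Sum using (_⊎_)
open import Relation.Binary.PropositionalEquality using (_≡_; _≢_)
open import Relation.Nullary using (Dec; yes; no; ¬_)
open import Function.Bundles using (_↔_; Inverse)
open import Algebra.Structures using (IsCommutativeRing)

-- A finite field 𝔽_q (q = 2 + q′ elements), together with a fixed
-- enumeration 𝔽_q = {a₀, …, a_{q-1}} with a₀ = 0 and a₁ = 1.

record FiniteField : Set₁ where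
  field
    Carrier : Set
    _+_ _*_ : Carrier → Carrier → Carrier
    -_      : Carrier → Carrier
    0# 1#   : Carrier
    isCommutativeRing : IsCommutativeRing _≡_ _+_ _*_ -_ 0# 1#
    _⁻¹     : Carrier → Carrier
    inverse : ∀ x → x ≢ 0# → x * (x ⁻¹) ≡ 1#
    _≟_     : (x y : Carrier) → Dec (x ≡ y)
    q′      : ℕ
    enum    : Fin (suc (suc q′)) ↔ Carrier
    enum-0  : Inverse.to enum Fin.zero ≡ 0#
    enum-1  : Inverse.to enum (Fin.suc Fin.zero) ≡ 1#

  q : ℕ
  q = suc (suc q′)

-- Polynomials over 𝔽_q: coefficient lists, lowest degree first.
-- A polynomial is *normal* if it has no trailing zero coefficient;
-- normal lists are in bijection with 𝔽_q[X] (the zero polynomial is []).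

module Poly (𝔽 : FiniteField) where
  open FiniteField 𝔽

  Pol : Set
  Pol = List Carrier

  strip : Pol → Pol
  strip [] = []
  strip (x ∷ xs) with strip xs
  ... | y ∷ ys = x ∷ y ∷ ys
  ... | [] with x ≟ 0#
  ...   | yes _ = []
  ...   | no  _ = x ∷ []

  Normal : Pol → Set
  Normal p = strip p ≡ p

  -- number of coefficients = deg + 1 for nonzero normal polynomials
  len : Pol → ℕ
  len = length

  addR : Pol → Pol → Pol
  addR [] ys = ys
  addR (x ∷ xs) [] = x ∷ xs
  addR (x ∷ xs) (y ∷ ys) = (x + y) ∷ addR xs ys

  add : Pol → Pol → Pol
  add a b = strip (addR a b)

  neg : Pol → Pol
  neg = map -_

  sub : Pol → Pol → Pol
  sub a b = add a (neg b)

  scale : Carrier → Pol → Pol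
  scale c = map (c *_)

  mulR : Pol → Pol → Pol
  mulR [] ys = []
  mulR (x ∷ xs) ys = addR (scale x ys) (0# ∷ mulR xs ys)

  mul : Pol → Pol → Pol
  mul a b = strip (mulR a b)

  lead : Pol → Carrier
  lead [] = 0#
  lead (x ∷ []) = x
  lead (x ∷ y ∷ ys) = lead (y ∷ ys)

  monomial : ℕ → Carrier → Pol
  monomial d c = strip (replicate d 0# ++ (c ∷ []))

  divmodF : ℕ → Pol → Pol → Pol × Pol
  divmodF zero A P = [] , strip A
  divmodF (suc f) A P with strip A
  ... | A′ with length A′ <? length P
  ...   | yes _ = [] , A′
  ...   | no  _ =
          let m  = monomial (length A′ ∸ length P) (lead A′ * (lead P ⁻¹))
              qr = divmodF f (sub A′ (mul m P)) P
          in add (proj₁ qr) m , proj₂ qr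

  -- quotient and remainder of A upon division by P (P ≠ 0);
  -- the fuel length A + 1 always suffices.
  quot : Pol → Pol → Pol
  quot A P = proj₁ (divmodF (suc (length A)) A P)

  rem : Pol → Pol → Pol
  rem A P = proj₂ (divmodF (suc (length A)) A P)

  _∣_ : Pol → Pol → Set
  D ∣ A = ∃[ E ] (mul D E ≡ strip A)

  -- every common divisor is a unit (a nonzero constant)
  Coprime : Pol → Pol → Set
  Coprime A B = ∀ D → Normal D → D ∣ A → D ∣ B → length D ≡ 1

  -- the index n of a polynomial a_n = Σ a_{n_i} X^i, n = Σ n_i q^i
  idx : Carrier → ℕ
  idx x = toℕ (Inverse.from enum x)

  polyIndex : Pol → ℕ
  polyIndex [] = 0
  polyIndex (c ∷ cs) = idx c ℕ.+ q ℕ.* polyIndex cs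

  _⊏ₚ_ : Pol → Pol → Set
  s ⊏ₚ t = polyIndex s < polyIndex t

  module Digits (P Q : Pol) where

    digitOf : Pol → Pol
    digitOf w = rem (mul Q w) P

    wSeq : Pol → ℕ → Pol
    wSeq w zero = strip w
    wSeq w (suc i) = quot (sub (mul Q (wSeq w i)) (digitOf (wSeq w i))) P

    digit : Pol → ℕ → Pol
    digit w i = digitOf (wSeq w i)

    VanishesAfter : Pol → ℕ → Set
    VanishesAfter w k = ∀ i → k < i → wSeq w i ≡ []

    DigitLength : Pol → ℕ → Set
    DigitLength w k = VanishesAfter w k × (∀ k′ → VanishesAfter w k′ → k ≤ k′)

    -- s^{(m)}(w).  For m ≤ k this is s_m; for m > k we have w_m = 0, so
    -- s_m = rem(Q·0, P) = 0 by definition, hence s^{(m)}(w) = s_m for all m.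
    sdig : ℕ → Pol → Pol
    sdig m w = digit w m

    _⊏_ : Pol → Pol → Set
    w ⊏ v = ∃[ k ] ∃[ ℓ ] (DigitLength w k × DigitLength v ℓ ×
              (k < ℓ ⊎ (k ≡ ℓ × ∃[ i ] (i ≤ k × digit w i ⊏ₚ digit v i ×
                   (∀ j → i < j → j ≤ k → digit w j ≡ digit v j)))))

    IsDigitEnumeration : (ℕ → Pol) → Set
    IsDigitEnumeration b =
      (∀ n → Normal (b n)) ×
      (∀ w → Normal w → ∃[ n ] (b n ≡ w)) ×
      (∀ n n′ → n < n′ → b n ⊏ b n′)

module Submission where

-- The parent map  w ↦ w₁ = (Q·w - s₀)/P  deletes the lowest
-- digit: the digits of w₁ are those of w shifted down by one place.
-- Every polynomial w has exactly r children (the v with v₁ = w), namely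
-- v₀ + u with deg u < deg P - deg Q, where w·P = Q·v₀ + ρ; and the digit
-- order satisfies  w₁ ⊏ v₁ ⇒ w ⊏ v.  Read on indices, the parent map is
-- therefore a monotone map ℕ → ℕ whose fibres all have r elements, so
-- it sends r·t + k (k < r) to t.  Iterating m times, the m-th ancestor
-- of b (r^m·t + k) is b t, and the m-th digit of any polynomial is the
-- lowest digit of its m-th ancestor.

open import Defs
open import Data.Nat using (ℕ; _<_; _+_; _*_; _^_; _∸_)
open import Data.List using (List; length)
open import Relation.Binary.PropositionalEquality using (_≡_)

open import Level using (0ℓ)
open import Data.Nat using (zero; suc; _≤_; _≤?_; _<?_; z≤n; s≤s; NonZero)
import Data.Nat.Properties as ℕₚ
open import Data.Nat.DivMod using (_/_; _%_)
import Data.Nat.DivMod as DivModₚ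
open import Data.Nat.Solver using (module +-*-Solver)
open import Data.Fin using (Fin; toℕ; fromℕ<; combine; remQuot)
import Data.Fin as Fin
import Data.Fin.Properties as Finₚ
open import Data.List using ([]; _∷_; replicate; _++_)
import Data.List.Properties as Listₚ
open import Data.Product using (∃-syntax; _×_; _,_; proj₁; proj₂; uncurry)
open import Data.Sum using (_⊎_; inj₁; inj₂)
open import Data.Empty using (⊥; ⊥-elim)
open import Relation.Nullary using (yes; no)
open import Relation.Binary.Definitions using (tri<; tri≈; tri>)
open import Relation.Binary.PropositionalEquality
  using (_≢_; refl; sym; trans; cong; cong₂; subst; subst₂; module ≡-Reasoning)
open import Function.Bundles using (Inverse)
open import Function.Definitions using (Injective)
open import Algebra.Bundles using (CommutativeRing)

-- A monotone map  f : ℕ → ℕ  all of whose fibres have exactly r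
-- elements (each fibre f⁻¹(t) is enumerated bijectively by  child t)
-- maps the block [r·t, r·t + r) onto t.  By induction on t one shows
-- that  f m < t  iff  m < r·t; the fibre of t is then an interval
-- starting at r·t, and counting its r elements pins down its end.
module MonotoneFibres
  (r : ℕ) (f : ℕ → ℕ) (f-mono : ∀ {m n} → m ≤ n → f m ≤ f n)
  (child : ℕ → Fin r → ℕ)
  (child-in-fibre : ∀ t i → f (child t i) ≡ t)
  (child-injective : ∀ t → Injective _≡_ _≡_ (child t))
  (child-onto : ∀ t m → f m ≡ t → ∃[ i ] child t i ≡ m)
  where

  InitialBlock : ℕ → Set
  InitialBlock t = ∀ m → (f m < t → m < r * t) × (m < r * t → f m < t)

  initialBlock-zero : InitialBlock 0
  initialBlock-zero m = (λ ()) , λ m<r*0 → ⊥-elim (ℕₚ.n≮0 (subst (m <_) (ℕₚ.*-zeroʳ r) m<r*0))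

  module _ (t : ℕ) (below : InitialBlock t) where

    from-block-end : ∀ m → r * t ≤ m → t ≤ f m
    from-block-end m rt≤m with t ≤? f m
    ... | yes t≤fm = t≤fm
    ... | no  t≰fm = ⊥-elim (ℕₚ.<⇒≱ (proj₁ (below m) (ℕₚ.≰⇒> t≰fm)) rt≤m)

    -- a fibre element ≥ r·t + r would force r + 1 distinct elements
    -- r·t, …, r·t + r into the fibre of t
    fibre-bounded : ∀ m → f m ≡ t → m < r * t + r
    fibre-bounded m fm≡t with suc m ≤? r * t + r
    ... | yes m<end = m<end
    ... | no  m≮end = ⊥-elim (ℕₚ.<-irrefl refl (Finₚ.injective⇒≤ index-injective))
      where
      end≤m : r * t + r ≤ m
      end≤m = ℕₚ.≤-pred (ℕₚ.≰⇒> m≮end)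
      in-fibre : (j : Fin (suc r)) → f (r * t + toℕ j) ≡ t
      in-fibre j = ℕₚ.≤-antisym
        (subst (f (r * t + toℕ j) ≤_) fm≡t
          (f-mono (ℕₚ.≤-trans (ℕₚ.+-monoʳ-≤ (r * t) (ℕₚ.≤-pred (Finₚ.toℕ<n j))) end≤m)))
        (from-block-end _ (ℕₚ.m≤m+n _ _))
      index : Fin (suc r) → Fin r
      index j = proj₁ (child-onto t _ (in-fibre j))
      index-spec : ∀ j → child t (index j) ≡ r * t + toℕ j
      index-spec j = proj₂ (child-onto t _ (in-fibre j))
      index-injective : Injective _≡_ _≡_ index
      index-injective {i} {j} eq = Finₚ.toℕ-injective (ℕₚ.+-cancelˡ-≡ (r * t) _ _
        (trans (sym (index-spec i)) (trans (cong (child t) eq) (index-spec j))))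

    -- if some m in the block [r·t, r·t + r) left the fibre of t, all r
    -- elements of the fibre would lie in the shorter interval [r·t, m)
    block-in-fibre : ∀ m → r * t ≤ m → m < r * t + r → f m ≡ t
    block-in-fibre m rt≤m m<end with f m ℕₚ.≟ t
    ... | yes fm≡t = fm≡t
    ... | no  fm≢t = ⊥-elim (ℕₚ.<⇒≱ offset<r (Finₚ.injective⇒≤ offset-injective))
      where
      t<fm : t < f m
      t<fm = ℕₚ.≤∧≢⇒< (from-block-end m rt≤m) (λ t≡fm → fm≢t (sym t≡fm))
      child<m : ∀ i → child t i < m
      child<m i with m ≤? child t i
      ... | yes m≤c = ⊥-elim (ℕₚ.<⇒≱ t<fm (subst (f m ≤_) (child-in-fibre t i) (f-mono m≤c)))
      ... | no  m≰c = ℕₚ.≰⇒> m≰c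
      rt≤child : ∀ i → r * t ≤ child t i
      rt≤child i with r * t ≤? child t i
      ... | yes rt≤c = rt≤c
      ... | no  rt≰c = ⊥-elim (ℕₚ.<-irrefl (child-in-fibre t i) (proj₂ (below _) (ℕₚ.≰⇒> rt≰c)))
      offset<r : m ∸ r * t < r
      offset<r = subst (m ∸ r * t <_) (ℕₚ.m+n∸m≡n (r * t) r) (ℕₚ.∸-monoˡ-< m<end rt≤m)
      offset : Fin r → Fin (m ∸ r * t)
      offset i = fromℕ< (ℕₚ.∸-monoˡ-< (child<m i) (rt≤child i))
      offset-injective : Injective _≡_ _≡_ offset
      offset-injective {i} {j} eq = child-injective t
        (ℕₚ.∸-cancelʳ-≡ (rt≤child i) (rt≤child j)
          (trans (sym (Finₚ.toℕ-fromℕ< _)) (trans (cong toℕ eq) (Finₚ.toℕ-fromℕ< _))))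

    initialBlock-suc : InitialBlock (suc t)
    initialBlock-suc m = to , from
      where
      rt+r : r * suc t ≡ r * t + r
      rt+r = trans (ℕₚ.*-suc r t) (ℕₚ.+-comm r (r * t))
      to : f m < suc t → m < r * suc t
      to fm<1+t with ℕₚ.m≤n⇒m<n∨m≡n (ℕₚ.≤-pred fm<1+t)
      ... | inj₁ fm<t = subst (m <_) (sym rt+r) (ℕₚ.<-≤-trans (proj₁ (below m) fm<t) (ℕₚ.m≤m+n _ _))
      ... | inj₂ fm≡t = subst (m <_) (sym rt+r) (fibre-bounded m fm≡t)
      from : m < r * suc t → f m < suc t
      from m<end with r * t ≤? m
      ... | yes rt≤m = s≤s (ℕₚ.≤-reflexive (block-in-fibre m rt≤m (subst (m <_) rt+r m<end)))
      ... | no  rt≰m = ℕₚ.m<n⇒m<1+n (proj₂ (below m) (ℕₚ.≰⇒> rt≰m))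

  initialBlock : ∀ t → InitialBlock t
  initialBlock zero    = initialBlock-zero
  initialBlock (suc t) = initialBlock-suc t (initialBlock t)

  fibre-block : ∀ t k → k < r → f (r * t + k) ≡ t
  fibre-block t k k<r =
    block-in-fibre t (initialBlock t) _ (ℕₚ.m≤m+n _ _) (ℕₚ.+-monoʳ-< (r * t) k<r)

-- Two lists are
-- compared coefficientwise (_≈_), and `strip` turns ≈ into ≡ on normal
-- lists, so the ring laws below are proved one coefficient at a time.
module Polynomials (𝔽 : FiniteField) where
  open FiniteField 𝔽 renaming (_+_ to infixl 6 _⊕_; _*_ to infixl 7 _⊗_; -_ to infix 8 ⊝_)
  open Poly 𝔽

  fieldRing : CommutativeRing 0ℓ 0ℓ
  fieldRing = record { isCommutativeRing = isCommutativeRing }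

  open CommutativeRing fieldRing
    using (+-assoc; +-comm; +-identityˡ; +-identityʳ; -‿inverseʳ;
           *-assoc; *-comm; *-identityˡ; *-identityʳ; distribʳ; zeroˡ; zeroʳ;
           ring; +-commutativeSemigroup)
  open import Algebra.Properties.Ring ring
    using (-0#≈0#; -‿+-comm; -‿distribˡ-*; +-cancelˡ;
           x∙y⁻¹≈ε⇒x≈y; \\-leftDividesˡ; //-rightDividesʳ)
  open import Algebra.Properties.CommutativeSemigroup +-commutativeSemigroup
    using (interchange; x∙yz≈y∙xz; xy∙z≈xz∙y)
  open ≡-Reasoning

  nonzero-product : ∀ a b → a ≢ 0# → b ≢ 0# → a ⊗ b ≢ 0#
  nonzero-product a b a≢0 b≢0 ab≡0 = b≢0 (begin
    b                  ≡⟨ sym (*-identityˡ b) ⟩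
    1# ⊗ b             ≡⟨ cong (_⊗ b) (sym (trans (*-comm (a ⁻¹) a) (inverse a a≢0))) ⟩
    (a ⁻¹) ⊗ a ⊗ b     ≡⟨ *-assoc (a ⁻¹) a b ⟩
    (a ⁻¹) ⊗ (a ⊗ b)   ≡⟨ cong ((a ⁻¹) ⊗_) ab≡0 ⟩
    (a ⁻¹) ⊗ 0#        ≡⟨ zeroʳ _ ⟩
    0#                 ∎)

  divide-multiply : ∀ a b → b ≢ 0# → a ⊗ (b ⁻¹) ⊗ b ≡ a
  divide-multiply a b b≢0 = begin
    a ⊗ (b ⁻¹) ⊗ b    ≡⟨ *-assoc a (b ⁻¹) b ⟩
    a ⊗ ((b ⁻¹) ⊗ b)  ≡⟨ cong (a ⊗_) (trans (*-comm (b ⁻¹) b) (inverse b b≢0)) ⟩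
    a ⊗ 1#            ≡⟨ *-identityʳ a ⟩
    a                 ∎

  cancel-sub : ∀ a b → (a ⊕ b) ⊕ ⊝ b ≡ a
  cancel-sub a b = //-rightDividesʳ b a

  add-sub-cancel : ∀ a b → a ⊕ (b ⊕ ⊝ a) ≡ b
  add-sub-cancel a b = trans (x∙yz≈y∙xz a b (⊝ a)) (trans (cong (b ⊕_) (-‿inverseʳ a)) (+-identityʳ b))

  transpose : ∀ a b c d → a ⊕ b ≡ c ⊕ d → a ⊕ ⊝ c ≡ d ⊕ ⊝ b
  transpose a b c d eq = begin
    a ⊕ ⊝ c                 ≡⟨ sym (cancel-sub (a ⊕ ⊝ c) b) ⟩
    (a ⊕ ⊝ c) ⊕ b ⊕ ⊝ b     ≡⟨ cong (_⊕ ⊝ b) (trans (+-assoc a (⊝ c) b)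
                                 (trans (cong (a ⊕_) (+-comm (⊝ c) b)) (sym (+-assoc a b (⊝ c))))) ⟩
    (a ⊕ b) ⊕ ⊝ c ⊕ ⊝ b     ≡⟨ cong (λ z → z ⊕ ⊝ c ⊕ ⊝ b) eq ⟩
    (c ⊕ d) ⊕ ⊝ c ⊕ ⊝ b     ≡⟨ cong (_⊕ ⊝ b) (trans (cong (_⊕ ⊝ c) (+-comm c d)) (cancel-sub d c)) ⟩
    d ⊕ ⊝ b                 ∎

  move-right : ∀ a b c → a ≡ b ⊕ c → a ⊕ ⊝ c ≡ b
  move-right a b c eq = trans (cong (_⊕ ⊝ c) eq) (cancel-sub b c)

  move-left : ∀ a b c → a ⊕ ⊝ c ≡ b → a ≡ b ⊕ c
  move-left a b c eq = begin
    a                  ≡⟨ sym (\\-leftDividesˡ c a) ⟩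
    c ⊕ (⊝ c ⊕ a)      ≡⟨ cong (c ⊕_) (+-comm (⊝ c) a) ⟩
    c ⊕ (a ⊕ ⊝ c)      ≡⟨ cong (c ⊕_) eq ⟩
    c ⊕ b              ≡⟨ +-comm c b ⟩
    b ⊕ c              ∎

  regroup : ∀ {W V R U} → W ≡ V ⊕ R → V ⊕ U ≡ W ⊕ (U ⊕ ⊝ R)
  regroup {W} {V} {R} {U} W≡V+R = begin
    V ⊕ U                  ≡⟨ cong (V ⊕_) (sym (add-sub-cancel R U)) ⟩
    V ⊕ (R ⊕ (U ⊕ ⊝ R))    ≡⟨ sym (+-assoc V R _) ⟩
    V ⊕ R ⊕ (U ⊕ ⊝ R)      ≡⟨ cong (_⊕ (U ⊕ ⊝ R)) (sym W≡V+R) ⟩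
    W ⊕ (U ⊕ ⊝ R)          ∎

  cancel-common : ∀ {W V R S} → W ≡ V ⊕ R → (W ⊕ S) ⊕ ⊝ V ≡ S ⊕ R
  cancel-common {W} {V} {R} {S} W≡V+R = begin
    (W ⊕ S) ⊕ ⊝ V          ≡⟨ cong (λ z → (z ⊕ S) ⊕ ⊝ V) W≡V+R ⟩
    (V ⊕ R ⊕ S) ⊕ ⊝ V      ≡⟨ cong (_⊕ ⊝ V) (trans (+-assoc V R S) (+-comm V (R ⊕ S))) ⟩
    (R ⊕ S ⊕ V) ⊕ ⊝ V      ≡⟨ cancel-sub (R ⊕ S) V ⟩
    R ⊕ S                  ≡⟨ +-comm R S ⟩
    S ⊕ R                  ∎

  coeff : Pol → ℕ → Carrier
  coeff []       i       = 0#
  coeff (x ∷ xs) zero    = x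
  coeff (x ∷ xs) (suc i) = coeff xs i

  infix 4 _≈_
  record _≈_ (a b : Pol) : Set where
    constructor mk≈
    field at : ∀ i → coeff a i ≡ coeff b i
  open _≈_ public

  ≈-refl : ∀ {a} → a ≈ a
  ≈-refl = mk≈ λ _ → refl

  ≈-sym : ∀ {a b} → a ≈ b → b ≈ a
  ≈-sym a≈b = mk≈ λ i → sym (at a≈b i)

  ≈-trans : ∀ {a b c} → a ≈ b → b ≈ c → a ≈ c
  ≈-trans a≈b b≈c = mk≈ λ i → trans (at a≈b i) (at b≈c i)

  ∷-≈ : ∀ {x y xs ys} → x ≡ y → xs ≈ ys → (x ∷ xs) ≈ (y ∷ ys)
  ∷-≈ x≡y xs≈ys = mk≈ λ { zero → x≡y ; (suc i) → at xs≈ys i }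

  tail-≈ : ∀ {x y xs ys} → (x ∷ xs) ≈ (y ∷ ys) → xs ≈ ys
  tail-≈ eq = mk≈ λ i → at eq (suc i)

  coeff-addR : ∀ a b i → coeff (addR a b) i ≡ coeff a i ⊕ coeff b i
  coeff-addR []       b        i       = sym (+-identityˡ _)
  coeff-addR (x ∷ xs) []       i       = sym (+-identityʳ _)
  coeff-addR (x ∷ xs) (y ∷ ys) zero    = refl
  coeff-addR (x ∷ xs) (y ∷ ys) (suc i) = coeff-addR xs ys i

  coeff-neg : ∀ a i → coeff (neg a) i ≡ ⊝ coeff a i
  coeff-neg []       i       = sym -0#≈0#
  coeff-neg (x ∷ xs) zero    = refl
  coeff-neg (x ∷ xs) (suc i) = coeff-neg xs i

  coeff-scale : ∀ c a i → coeff (scale c a) i ≡ c ⊗ coeff a i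
  coeff-scale c []       i       = sym (zeroʳ c)
  coeff-scale c (x ∷ xs) zero    = refl
  coeff-scale c (x ∷ xs) (suc i) = coeff-scale c xs i

  addR-cong : ∀ {a a′ b b′} → a ≈ a′ → b ≈ b′ → addR a b ≈ addR a′ b′
  addR-cong {a} {a′} {b} {b′} a≈a′ b≈b′ = mk≈ λ i → begin
    coeff (addR a b) i        ≡⟨ coeff-addR a b i ⟩
    coeff a i ⊕ coeff b i     ≡⟨ cong₂ _⊕_ (at a≈a′ i) (at b≈b′ i) ⟩
    coeff a′ i ⊕ coeff b′ i   ≡⟨ sym (coeff-addR a′ b′ i) ⟩
    coeff (addR a′ b′) i      ∎

  neg-cong : ∀ {a a′} → a ≈ a′ → neg a ≈ neg a′
  neg-cong {a} {a′} a≈a′ = mk≈ λ i →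
    trans (coeff-neg a i) (trans (cong ⊝_ (at a≈a′ i)) (sym (coeff-neg a′ i)))

  -- strip removes trailing zeros and nothing else; stripCons is its
  -- recursive step, exposed so that strip (x ∷ xs) can be unfolded
  stripCons : Carrier → Pol → Pol
  stripCons x (y ∷ ys) = x ∷ y ∷ ys
  stripCons x [] with x ≟ 0#
  ... | yes _ = []
  ... | no  _ = x ∷ []

  strip-∷ : ∀ x xs → strip (x ∷ xs) ≡ stripCons x (strip xs)
  strip-∷ x xs with strip xs
  ... | y ∷ ys = refl
  ... | [] with x ≟ 0#
  ...   | yes _ = refl
  ...   | no  _ = refl

  stripCons-≈ : ∀ x s → stripCons x s ≈ (x ∷ s)
  stripCons-≈ x (y ∷ ys) = ≈-refl
  stripCons-≈ x [] with x ≟ 0#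
  ... | yes x≡0 = mk≈ λ { zero → sym x≡0 ; (suc i) → refl }
  ... | no  _   = ≈-refl

  strip-≈ : ∀ a → strip a ≈ a
  strip-≈ []       = ≈-refl
  strip-≈ (x ∷ xs) rewrite strip-∷ x xs =
    ≈-trans (stripCons-≈ x (strip xs)) (∷-≈ refl (strip-≈ xs))

  stripCons-zero : ∀ x → x ≡ 0# → stripCons x [] ≡ []
  stripCons-zero x x≡0 with x ≟ 0#
  ... | yes _   = refl
  ... | no  x≢0 = ⊥-elim (x≢0 x≡0)

  strip-cong : ∀ a b → a ≈ b → strip a ≡ strip b
  strip-cong []       []       _ = refl
  strip-cong []       (y ∷ ys) e
    rewrite strip-∷ y ys | sym (strip-cong [] ys (mk≈ λ i → at e (suc i)))
    = sym (stripCons-zero y (sym (at e zero)))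
  strip-cong (x ∷ xs) []       e
    rewrite strip-∷ x xs | strip-cong xs [] (mk≈ λ i → at e (suc i))
    = stripCons-zero x (at e zero)
  strip-cong (x ∷ xs) (y ∷ ys) e
    rewrite strip-∷ x xs | strip-∷ y ys | at e zero | strip-cong xs ys (tail-≈ e)
    = refl

  ≈⇒≡ : ∀ {a b} → Normal a → Normal b → a ≈ b → a ≡ b
  ≈⇒≡ {a} {b} na nb a≈b = trans (sym na) (trans (strip-cong a b a≈b) nb)

  strip-normal : ∀ a → Normal (strip a)
  strip-normal a = strip-cong (strip a) a (strip-≈ a)

  Bounded : Pol → ℕ → Set
  Bounded p n = ∀ i → n ≤ i → coeff p i ≡ 0#

  bounded-length : ∀ p → Bounded p (length p)
  bounded-length []       i       _         = refl
  bounded-length (x ∷ xs) (suc i) (s≤s n≤i) = bounded-length xs i n≤i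

  bounded-mono : ∀ p {m n} → m ≤ n → Bounded p m → Bounded p n
  bounded-mono p m≤n bnd i n≤i = bnd i (ℕₚ.≤-trans m≤n n≤i)

  bounded-≈ : ∀ {p p′ n} → p ≈ p′ → Bounded p n → Bounded p′ n
  bounded-≈ p≈p′ bnd i n≤i = trans (sym (at p≈p′ i)) (bnd i n≤i)

  bounded-addR : ∀ a b {n} → Bounded a n → Bounded b n → Bounded (addR a b) n
  bounded-addR a b ba bb i n≤i =
    trans (coeff-addR a b i) (trans (cong₂ _⊕_ (ba i n≤i) (bb i n≤i)) (+-identityʳ 0#))

  bounded-neg : ∀ {a n} → Bounded a n → Bounded (neg a) n
  bounded-neg {a} ba i n≤i = trans (coeff-neg a i) (trans (cong ⊝_ (ba i n≤i)) -0#≈0#)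

  length-stripCons : ∀ x s → length (stripCons x s) ≤ suc (length s)
  length-stripCons x (y ∷ ys) = ℕₚ.≤-refl
  length-stripCons x [] with x ≟ 0#
  ... | yes _ = z≤n
  ... | no  _ = s≤s z≤n

  length-strip : ∀ a → length (strip a) ≤ length a
  length-strip []       = z≤n
  length-strip (x ∷ xs) rewrite strip-∷ x xs =
    ℕₚ.≤-trans (length-stripCons x (strip xs)) (s≤s (length-strip xs))

  length-strip-bounded : ∀ p n → Bounded p n → length (strip p) ≤ n
  length-strip-bounded []       n       _   = z≤n
  length-strip-bounded (x ∷ xs) zero    bnd
    rewrite strip-cong (x ∷ xs) [] (mk≈ λ i → bnd i z≤n) = z≤n
  length-strip-bounded (x ∷ xs) (suc n) bnd rewrite strip-∷ x xs =
    ℕₚ.≤-trans (length-stripCons x (strip xs))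
      (s≤s (length-strip-bounded xs n (λ i n≤i → bnd (suc i) (s≤s n≤i))))

  length-normal-bounded : ∀ p n → Normal p → Bounded p n → length p ≤ n
  length-normal-bounded p n np bnd = subst (λ z → length z ≤ n) np (length-strip-bounded p n bnd)

  nonzero-below-bound : ∀ p n N → coeff p n ≢ 0# → Bounded p N → n < N
  nonzero-below-bound p n N pn≢0 bnd with N ≤? n
  ... | yes N≤n = ⊥-elim (pn≢0 (bnd n N≤n))
  ... | no  N≰n = ℕₚ.≰⇒> N≰n

  top-nonzero : ∀ x xs → Normal (x ∷ xs) → coeff (x ∷ xs) (length xs) ≢ 0#
  top-nonzero x xs nx top≡0 =
    ℕₚ.<-irrefl refl (length-normal-bounded (x ∷ xs) (length xs) nx bounded-below-top)
    where
    bounded-below-top : Bounded (x ∷ xs) (length xs)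
    bounded-below-top i len≤i with ℕₚ.m≤n⇒m<n∨m≡n len≤i
    ... | inj₁ len<i = bounded-length (x ∷ xs) i len<i
    ... | inj₂ refl  = top≡0

  lead-top : ∀ x xs → lead (x ∷ xs) ≡ coeff (x ∷ xs) (length xs)
  lead-top x []       = refl
  lead-top x (y ∷ ys) = lead-top y ys

  coeff-mulR-∷ : ∀ x xs b i → coeff (mulR (x ∷ xs) b) i ≡ x ⊗ coeff b i ⊕ coeff (0# ∷ mulR xs b) i
  coeff-mulR-∷ x xs b i =
    trans (coeff-addR (scale x b) (0# ∷ mulR xs b) i) (cong (_⊕ _) (coeff-scale x b i))

  shift-addR : ∀ p p′ → (0# ∷ addR p p′) ≈ addR (0# ∷ p) (0# ∷ p′)
  shift-addR p p′ = ∷-≈ (sym (+-identityʳ 0#)) ≈-refl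

  shift-neg : ∀ p → (0# ∷ neg p) ≈ neg (0# ∷ p)
  shift-neg p = ∷-≈ (sym -0#≈0#) ≈-refl

  zero-∷ : ∀ {p} → p ≈ [] → (0# ∷ p) ≈ []
  zero-∷ p≈0 = mk≈ λ { zero → refl ; (suc i) → at p≈0 i }

  mulR-zeroˡ : ∀ a b → a ≈ [] → mulR a b ≈ []
  mulR-zeroˡ []       b _   = ≈-refl
  mulR-zeroˡ (x ∷ xs) b a≈0 = mk≈ λ i → begin
    coeff (mulR (x ∷ xs) b) i                  ≡⟨ coeff-mulR-∷ x xs b i ⟩
    x ⊗ coeff b i ⊕ coeff (0# ∷ mulR xs b) i   ≡⟨ cong₂ _⊕_ (trans (cong (_⊗ _) (at a≈0 zero)) (zeroˡ _))
                                                    (at (zero-∷ (mulR-zeroˡ xs b (mk≈ λ j → at a≈0 (suc j)))) i) ⟩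
    0# ⊕ 0#                                    ≡⟨ +-identityʳ 0# ⟩
    0#                                         ∎

  mulR-zeroʳ : ∀ a → mulR a [] ≈ []
  mulR-zeroʳ []       = ≈-refl
  mulR-zeroʳ (x ∷ xs) = mk≈ λ i → begin
    coeff (mulR (x ∷ xs) []) i                  ≡⟨ coeff-mulR-∷ x xs [] i ⟩
    x ⊗ 0# ⊕ coeff (0# ∷ mulR xs []) i          ≡⟨ cong₂ _⊕_ (zeroʳ x) (at (zero-∷ (mulR-zeroʳ xs)) i) ⟩
    0# ⊕ 0#                                     ≡⟨ +-identityʳ 0# ⟩
    0#                                          ∎

  mulR-congˡ : ∀ {a a′} b → a ≈ a′ → mulR a b ≈ mulR a′ b
  mulR-congˡ {[]}     {[]}     b _    = ≈-refl
  mulR-congˡ {[]}     {y ∷ ys} b 0≈a′ = ≈-sym (mulR-zeroˡ (y ∷ ys) b (≈-sym 0≈a′))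
  mulR-congˡ {x ∷ xs} {[]}     b a≈0  = mulR-zeroˡ (x ∷ xs) b a≈0
  mulR-congˡ {x ∷ xs} {y ∷ ys} b a≈a′ = addR-cong
    (mk≈ λ i → trans (coeff-scale x b i) (trans (cong (_⊗ _) (at a≈a′ zero)) (sym (coeff-scale y b i))))
    (∷-≈ refl (mulR-congˡ b (tail-≈ a≈a′)))

  mulR-distribʳ : ∀ a a′ b → mulR (addR a a′) b ≈ addR (mulR a b) (mulR a′ b)
  mulR-distribʳ []       a′       b = ≈-refl
  mulR-distribʳ (x ∷ xs) []       b = mk≈ λ i →
    sym (trans (coeff-addR (mulR (x ∷ xs) b) [] i) (+-identityʳ _))
  mulR-distribʳ (x ∷ xs) (y ∷ ys) b = mk≈ λ i → begin
    coeff (mulR ((x ⊕ y) ∷ addR xs ys) b) i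
      ≡⟨ coeff-mulR-∷ (x ⊕ y) (addR xs ys) b i ⟩
    (x ⊕ y) ⊗ coeff b i ⊕ coeff (0# ∷ mulR (addR xs ys) b) i
      ≡⟨ cong₂ _⊕_ (distribʳ (coeff b i) x y)
           (trans (at (≈-trans (∷-≈ refl (mulR-distribʳ xs ys b)) (shift-addR (mulR xs b) (mulR ys b))) i)
                  (coeff-addR (0# ∷ mulR xs b) (0# ∷ mulR ys b) i)) ⟩
    (x ⊗ coeff b i ⊕ y ⊗ coeff b i) ⊕ (coeff (0# ∷ mulR xs b) i ⊕ coeff (0# ∷ mulR ys b) i)
      ≡⟨ interchange _ _ _ _ ⟩
    (x ⊗ coeff b i ⊕ coeff (0# ∷ mulR xs b) i) ⊕ (y ⊗ coeff b i ⊕ coeff (0# ∷ mulR ys b) i)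
      ≡⟨ sym (cong₂ _⊕_ (coeff-mulR-∷ x xs b i) (coeff-mulR-∷ y ys b i)) ⟩
    coeff (mulR (x ∷ xs) b) i ⊕ coeff (mulR (y ∷ ys) b) i
      ≡⟨ sym (coeff-addR (mulR (x ∷ xs) b) (mulR (y ∷ ys) b) i) ⟩
    coeff (addR (mulR (x ∷ xs) b) (mulR (y ∷ ys) b)) i ∎

  mulR-negˡ : ∀ a b → mulR (neg a) b ≈ neg (mulR a b)
  mulR-negˡ []       b = ≈-refl
  mulR-negˡ (x ∷ xs) b = mk≈ λ i → begin
    coeff (mulR (⊝ x ∷ neg xs) b) i
      ≡⟨ coeff-mulR-∷ (⊝ x) (neg xs) b i ⟩
    ⊝ x ⊗ coeff b i ⊕ coeff (0# ∷ mulR (neg xs) b) i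
      ≡⟨ cong₂ _⊕_ (sym (-‿distribˡ-* x _))
           (trans (at (≈-trans (∷-≈ refl (mulR-negˡ xs b)) (shift-neg (mulR xs b))) i)
                  (coeff-neg (0# ∷ mulR xs b) i)) ⟩
    ⊝ (x ⊗ coeff b i) ⊕ ⊝ coeff (0# ∷ mulR xs b) i
      ≡⟨ -‿+-comm _ _ ⟩
    ⊝ (x ⊗ coeff b i ⊕ coeff (0# ∷ mulR xs b) i)
      ≡⟨ cong ⊝_ (sym (coeff-mulR-∷ x xs b i)) ⟩
    ⊝ coeff (mulR (x ∷ xs) b) i
      ≡⟨ sym (coeff-neg (mulR (x ∷ xs) b) i) ⟩
    coeff (neg (mulR (x ∷ xs) b)) i ∎

  mulR-∷ʳ : ∀ a y ys → mulR a (y ∷ ys) ≈ addR (scale y a) (0# ∷ mulR a ys)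
  mulR-∷ʳ []       y ys = mk≈ λ { zero → refl ; (suc i) → refl }
  mulR-∷ʳ (x ∷ xs) y ys = mk≈ λ
    { zero → trans (coeff-mulR-∷ x xs (y ∷ ys) zero) (cong (_⊕ 0#) (*-comm x y))
    ; (suc i) → begin
        coeff (mulR (x ∷ xs) (y ∷ ys)) (suc i)
          ≡⟨ coeff-mulR-∷ x xs (y ∷ ys) (suc i) ⟩
        x ⊗ coeff ys i ⊕ coeff (mulR xs (y ∷ ys)) i
          ≡⟨ cong (x ⊗ coeff ys i ⊕_) (trans (at (mulR-∷ʳ xs y ys) i) (coeff-addR (scale y xs) _ i)) ⟩
        x ⊗ coeff ys i ⊕ (coeff (scale y xs) i ⊕ coeff (0# ∷ mulR xs ys) i)
          ≡⟨ x∙yz≈y∙xz _ _ _ ⟩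
        coeff (scale y xs) i ⊕ (x ⊗ coeff ys i ⊕ coeff (0# ∷ mulR xs ys) i)
          ≡⟨ cong (coeff (scale y xs) i ⊕_) (sym (coeff-mulR-∷ x xs ys i)) ⟩
        coeff (scale y xs) i ⊕ coeff (mulR (x ∷ xs) ys) i
          ≡⟨ sym (coeff-addR (scale y xs) (mulR (x ∷ xs) ys) i) ⟩
        coeff (addR (scale y (x ∷ xs)) (0# ∷ mulR (x ∷ xs) ys)) (suc i) ∎ }

  mulR-comm : ∀ a b → mulR a b ≈ mulR b a
  mulR-comm a []       = mulR-zeroʳ a
  mulR-comm a (y ∷ ys) = ≈-trans (mulR-∷ʳ a y ys) (addR-cong ≈-refl (∷-≈ refl (mulR-comm a ys)))

  mulR-congʳ : ∀ a {b b′} → b ≈ b′ → mulR a b ≈ mulR a b′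
  mulR-congʳ a {b} {b′} b≈b′ =
    ≈-trans (mulR-comm a b) (≈-trans (mulR-congˡ a b≈b′) (mulR-comm b′ a))

  mulR-distribˡ : ∀ a b b′ → mulR a (addR b b′) ≈ addR (mulR a b) (mulR a b′)
  mulR-distribˡ a b b′ = ≈-trans (mulR-comm a _)
    (≈-trans (mulR-distribʳ b b′ a) (addR-cong (mulR-comm b a) (mulR-comm b′ a)))

  mulR-negʳ : ∀ a b → mulR a (neg b) ≈ neg (mulR a b)
  mulR-negʳ a b = ≈-trans (mulR-comm a (neg b))
    (≈-trans (mulR-negˡ b a) (neg-cong (mulR-comm b a)))

  bounded-scale : ∀ c a {n} → Bounded a n → Bounded (scale c a) n
  bounded-scale c a ba i n≤i = trans (coeff-scale c a i) (trans (cong (c ⊗_) (ba i n≤i)) (zeroʳ c))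

  bounded-shift : ∀ p {n} → Bounded p n → Bounded (0# ∷ p) (suc n)
  bounded-shift p bp (suc i) (s≤s n≤i) = bp i n≤i

  bounded-mulR : ∀ x xs y ys → Bounded (mulR (x ∷ xs) (y ∷ ys)) (suc (length xs + length ys))
  bounded-mulR x []         y ys = bounded-addR (scale x (y ∷ ys)) (0# ∷ [])
    (bounded-scale x (y ∷ ys) (bounded-length (y ∷ ys)))
    (bounded-shift [] (λ _ _ → refl))
  bounded-mulR x (x′ ∷ xs) y ys = bounded-addR (scale x (y ∷ ys)) (0# ∷ mulR (x′ ∷ xs) (y ∷ ys))
    (bounded-mono (scale x (y ∷ ys)) (s≤s (ℕₚ.m≤n+m (length ys) (suc (length xs))))
      (bounded-scale x (y ∷ ys) (bounded-length (y ∷ ys))))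
    (bounded-shift _ (bounded-mulR x′ xs y ys))

  top-mulR : ∀ x xs y ys → coeff (mulR (x ∷ xs) (y ∷ ys)) (length xs + length ys)
                         ≡ coeff (x ∷ xs) (length xs) ⊗ coeff (y ∷ ys) (length ys)
  top-mulR x []         y ys = begin
    coeff (mulR (x ∷ []) (y ∷ ys)) (length ys)
      ≡⟨ coeff-mulR-∷ x [] (y ∷ ys) (length ys) ⟩
    x ⊗ coeff (y ∷ ys) (length ys) ⊕ coeff (0# ∷ []) (length ys)
      ≡⟨ cong (x ⊗ coeff (y ∷ ys) (length ys) ⊕_) (at (zero-∷ ≈-refl) (length ys)) ⟩
    x ⊗ coeff (y ∷ ys) (length ys) ⊕ 0#
      ≡⟨ +-identityʳ _ ⟩
    x ⊗ coeff (y ∷ ys) (length ys) ∎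
  top-mulR x (x′ ∷ xs) y ys = begin
    coeff (mulR (x ∷ x′ ∷ xs) (y ∷ ys)) (suc (length xs + length ys))
      ≡⟨ coeff-mulR-∷ x (x′ ∷ xs) (y ∷ ys) (suc (length xs + length ys)) ⟩
    x ⊗ coeff (y ∷ ys) (suc (length xs + length ys))
      ⊕ coeff (mulR (x′ ∷ xs) (y ∷ ys)) (length xs + length ys)
      ≡⟨ cong₂ _⊕_ (cong (x ⊗_) (bounded-length (y ∷ ys) _ (s≤s (ℕₚ.m≤n+m (length ys) (length xs)))))
                   (top-mulR x′ xs y ys) ⟩
    x ⊗ 0# ⊕ coeff (x′ ∷ xs) (length xs) ⊗ coeff (y ∷ ys) (length ys)
      ≡⟨ cong (_⊕ coeff (x′ ∷ xs) (length xs) ⊗ coeff (y ∷ ys) (length ys)) (zeroʳ x) ⟩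
    0# ⊕ coeff (x′ ∷ xs) (length xs) ⊗ coeff (y ∷ ys) (length ys)
      ≡⟨ +-identityˡ _ ⟩
    coeff (x′ ∷ xs) (length xs) ⊗ coeff (y ∷ ys) (length ys) ∎

  top-mulR-nonzero : ∀ x xs y ys → Normal (x ∷ xs) → Normal (y ∷ ys)
                   → coeff (mulR (x ∷ xs) (y ∷ ys)) (length xs + length ys) ≢ 0#
  top-mulR-nonzero x xs y ys nx ny top≡0 = nonzero-product _ _
    (top-nonzero x xs nx) (top-nonzero y ys ny) (trans (sym (top-mulR x xs y ys)) top≡0)

  coeff-add : ∀ a b i → coeff (add a b) i ≡ coeff a i ⊕ coeff b i
  coeff-add a b i = trans (at (strip-≈ (addR a b)) i) (coeff-addR a b i)

  coeff-sub : ∀ a b i → coeff (sub a b) i ≡ coeff a i ⊕ ⊝ coeff b i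
  coeff-sub a b i = trans (coeff-add a (neg b) i) (cong (coeff a i ⊕_) (coeff-neg b i))

  coeff-mul : ∀ a b i → coeff (mul a b) i ≡ coeff (mulR a b) i
  coeff-mul a b i = at (strip-≈ (mulR a b)) i

  coeff-monomial-mulR : ∀ d c b j → coeff (mulR (replicate d 0# ++ (c ∷ [])) b) (d + j) ≡ c ⊗ coeff b j
  coeff-monomial-mulR zero    c b j = begin
    coeff (mulR (c ∷ []) b) j                ≡⟨ coeff-mulR-∷ c [] b j ⟩
    c ⊗ coeff b j ⊕ coeff (0# ∷ []) j        ≡⟨ cong (c ⊗ coeff b j ⊕_) (at (zero-∷ ≈-refl) j) ⟩
    c ⊗ coeff b j ⊕ 0#                       ≡⟨ +-identityʳ _ ⟩
    c ⊗ coeff b j                            ∎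
  coeff-monomial-mulR (suc d) c b j = begin
    coeff (mulR (0# ∷ replicate d 0# ++ (c ∷ [])) b) (suc (d + j))
      ≡⟨ coeff-mulR-∷ 0# (replicate d 0# ++ (c ∷ [])) b (suc (d + j)) ⟩
    0# ⊗ coeff b (suc (d + j)) ⊕ coeff (mulR (replicate d 0# ++ (c ∷ [])) b) (d + j)
      ≡⟨ cong₂ _⊕_ (zeroˡ _) (coeff-monomial-mulR d c b j) ⟩
    0# ⊕ c ⊗ coeff b j
      ≡⟨ +-identityˡ _ ⟩
    c ⊗ coeff b j ∎

  coeff-monomial-mul : ∀ d c b j → coeff (mul (monomial d c) b) (d + j) ≡ c ⊗ coeff b j
  coeff-monomial-mul d c b j = begin
    coeff (mul (monomial d c) b) (d + j)
      ≡⟨ coeff-mul (monomial d c) b _ ⟩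
    coeff (mulR (monomial d c) b) (d + j)
      ≡⟨ at (mulR-congˡ b (strip-≈ (replicate d 0# ++ (c ∷ [])))) (d + j) ⟩
    coeff (mulR (replicate d 0# ++ (c ∷ [])) b) (d + j)
      ≡⟨ coeff-monomial-mulR d c b j ⟩
    c ⊗ coeff b j ∎

  sub-≈-split : ∀ A M X R → sub A M ≈ addR X R → A ≈ addR (addR X M) R
  sub-≈-split A M X R eq = mk≈ λ i → begin
    coeff A i                                 ≡⟨ move-left _ _ _ (trans (sym (coeff-sub A M i))
                                                   (trans (at eq i) (coeff-addR X R i))) ⟩
    (coeff X i ⊕ coeff R i) ⊕ coeff M i       ≡⟨ xy∙z≈xz∙y _ _ _ ⟩
    (coeff X i ⊕ coeff M i) ⊕ coeff R i       ≡⟨ sym (trans (coeff-addR (addR X M) R i)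
                                                   (cong (_⊕ coeff R i) (coeff-addR X M i))) ⟩
    coeff (addR (addR X M) R) i               ∎

  module Division (p : Carrier) (ps : Pol) (nP : Normal (p ∷ ps)) where
    P : Pol
    P = p ∷ ps

    lead-P-nonzero : lead P ≢ 0#
    lead-P-nonzero lead≡0 = top-nonzero p ps nP (trans (sym (lead-top p ps)) lead≡0)

    DivisionIdentity : Pol → Pol × Pol → Set
    DivisionIdentity A (quo , re) = A ≈ addR (mulR quo P) re × length re < length P

    divmod-normal : ∀ f A → Normal (proj₁ (divmodF f A P)) × Normal (proj₂ (divmodF f A P))
    divmod-normal zero    A = refl , strip-normal A
    divmod-normal (suc f) A with strip A | strip-normal A
    ... | A′ | nA′ with length A′ <? length P
    ...   | yes _ = refl , nA′
    ...   | no  _ = strip-normal (addR (proj₁ (divmodF f A″ P)) m) , proj₂ (divmod-normal f A″)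
      where
      m A″ : Pol
      m  = monomial (length A′ ∸ length P) (lead A′ ⊗ (lead P ⁻¹))
      A″ = sub A′ (mul m P)

    module ReductionStep (a : Carrier) (as : Pol) (nA : Normal (a ∷ as))
                         (ps≤as : length ps ≤ length as) where
      d : ℕ
      d = length as ∸ length ps

      c : Carrier
      c = lead (a ∷ as) ⊗ (lead P ⁻¹)

      multiple : Pol
      multiple = mul (monomial d c) P

      reduced : Pol
      reduced = sub (a ∷ as) multiple

      reduced-normal : Normal reduced
      reduced-normal = strip-normal (addR (a ∷ as) (neg multiple))

      length-as : length as ≡ d + length ps
      length-as = sym (ℕₚ.m∸n+n≡m ps≤as)

      top-multiple : coeff (multiple) (length as) ≡ coeff (a ∷ as) (length as)
      top-multiple = begin
        coeff (multiple) (length as)       ≡⟨ cong (coeff (multiple)) length-as ⟩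
        coeff (multiple) (d + length ps)   ≡⟨ coeff-monomial-mul d c P (length ps) ⟩
        c ⊗ coeff P (length ps)                        ≡⟨ cong (c ⊗_) (sym (lead-top p ps)) ⟩
        lead (a ∷ as) ⊗ (lead P ⁻¹) ⊗ lead P           ≡⟨ divide-multiply _ _ lead-P-nonzero ⟩
        lead (a ∷ as)                                  ≡⟨ lead-top a as ⟩
        coeff (a ∷ as) (length as)                     ∎

      multiple-bounded : Bounded (multiple) (suc (length as))
      multiple-bounded i as<i = begin
        coeff (multiple) i                 ≡⟨ cong (coeff (multiple)) (sym i≡d+j) ⟩
        coeff (multiple) (d + (i ∸ d))     ≡⟨ coeff-monomial-mul d c P (i ∸ d) ⟩
        c ⊗ coeff P (i ∸ d)                            ≡⟨ cong (c ⊗_) (bounded-length P (i ∸ d) P≤j) ⟩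
        c ⊗ 0#                                         ≡⟨ zeroʳ c ⟩
        0#                                             ∎
        where
        d≤i : d ≤ i
        d≤i = ℕₚ.≤-trans (ℕₚ.m≤m+n d (length ps))
                (ℕₚ.≤-trans (ℕₚ.≤-reflexive (sym length-as)) (ℕₚ.<⇒≤ as<i))
        i≡d+j : d + (i ∸ d) ≡ i
        i≡d+j = ℕₚ.m+[n∸m]≡n d≤i
        P≤j : length P ≤ i ∸ d
        P≤j = ℕₚ.+-cancelˡ-≤ d _ _ (subst (d + length P ≤_) (sym i≡d+j)
                (subst (_≤ i) (trans (cong suc length-as) (sym (ℕₚ.+-suc d (length ps)))) as<i))

      reduced-bounded : Bounded reduced (length as)
      reduced-bounded i as≤i with ℕₚ.m≤n⇒m<n∨m≡n as≤i
      ... | inj₂ refl = begin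
        coeff reduced (length as)                                  ≡⟨ coeff-sub (a ∷ as) multiple (length as) ⟩
        coeff (a ∷ as) (length as) ⊕ ⊝ coeff (multiple) (length as)
                                                                   ≡⟨ cong (λ z → _ ⊕ ⊝ z) top-multiple ⟩
        coeff (a ∷ as) (length as) ⊕ ⊝ coeff (a ∷ as) (length as)  ≡⟨ -‿inverseʳ _ ⟩
        0#                                                         ∎
      ... | inj₁ as<i = begin
        coeff reduced i                                            ≡⟨ coeff-sub (a ∷ as) multiple i ⟩
        coeff (a ∷ as) i ⊕ ⊝ coeff (multiple) i        ≡⟨ cong₂ (λ u v → u ⊕ ⊝ v)
                                                                        (bounded-length (a ∷ as) i as<i)
                                                                        (multiple-bounded i as<i) ⟩
        0# ⊕ ⊝ 0#                                                  ≡⟨ -‿inverseʳ 0# ⟩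
        0#                                                         ∎

      reduced-shorter : length reduced < length (a ∷ as)
      reduced-shorter = s≤s (length-normal-bounded reduced (length as) reduced-normal reduced-bounded)

    divmod-correct : ∀ f A → length (strip A) ≤ f → DivisionIdentity A (divmodF (suc f) A P)
    divmod-correct f A fuel with strip A | strip-≈ A | strip-normal A
    ... | A′ | A′≈A | nA′ with length A′ <? length P
    ...   | yes short = ≈-sym A′≈A , short
    divmod-correct f       A fuel | []     | _    | _   | no long = ⊥-elim (long (s≤s z≤n))
    divmod-correct zero    A ()   | a ∷ as | _    | _   | no long
    divmod-correct (suc f) A fuel | a ∷ as | A′≈A | nA′ | no long =
      ≈-trans (≈-sym A′≈A) (≈-trans (sub-≈-split (a ∷ as) multiple (mulR quo P) re (proj₁ IH))
                                    (addR-cong (≈-sym new-quotient) ≈-refl)) ,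
      proj₂ IH
      where
      open ReductionStep a as nA′ (ℕₚ.≤-pred (ℕₚ.≮⇒≥ long))
      IH : DivisionIdentity reduced (divmodF (suc f) reduced P)
      IH = divmod-correct f reduced
        (subst (λ z → length z ≤ f) (sym reduced-normal) (ℕₚ.≤-pred (ℕₚ.≤-trans reduced-shorter fuel)))
      quo re : Pol
      quo = proj₁ (divmodF (suc f) reduced P)
      re  = proj₂ (divmodF (suc f) reduced P)
      new-quotient : mulR (add quo (monomial d c)) P ≈ addR (mulR quo P) multiple
      new-quotient =
        ≈-trans (mulR-congˡ P (strip-≈ (addR quo (monomial d c))))
          (≈-trans (mulR-distribʳ quo (monomial d c) P)
            (addR-cong ≈-refl (≈-sym (strip-≈ (mulR (monomial d c) P)))))

    division-identity : ∀ A → DivisionIdentity A (quot A P , rem A P)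
    division-identity A = divmod-correct (length A) A (length-strip A)

    quot-normal : ∀ A → Normal (quot A P)
    quot-normal A = proj₁ (divmod-normal (suc (length A)) A)

    rem-normal : ∀ A → Normal (rem A P)
    rem-normal A = proj₂ (divmod-normal (suc (length A)) A)

    short-bounded : ∀ s → length s < length P → Bounded s (length ps)
    short-bounded s (s≤s s≤ps) = bounded-mono s s≤ps (bounded-length s)

    small-multiple : ∀ D → Bounded (mulR D P) (length ps) → D ≈ []
    small-multiple D bnd with strip D | strip-≈ D | strip-normal D
    ... | []     | D′≈D | _  = ≈-sym D′≈D
    ... | y ∷ ys | D′≈D | nD′ = ⊥-elim (ℕₚ.<-irrefl refl
      (ℕₚ.≤-trans (s≤s (ℕₚ.m≤n+m (length ps) (length ys)))
        (nonzero-below-bound (mulR (y ∷ ys) P) _ (length ps)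
          (top-mulR-nonzero y ys p ps nD′ nP)
          (bounded-≈ (mulR-congˡ P (≈-sym D′≈D)) bnd))))

    division-unique : ∀ A x s → Normal x → Normal s → length s < length P →
                      A ≈ addR (mulR x P) s → quot A P ≡ x × rem A P ≡ s
    division-unique A x s nx ns s<P A≈xP+s = quot≡x , rem≡s
      where
      quo re : Pol
      quo = quot A P
      re  = rem A P
      D : Pol
      D = addR x (neg quo)
      coeff-DP : ∀ i → coeff (mulR D P) i ≡ coeff re i ⊕ ⊝ coeff s i
      coeff-DP i = begin
        coeff (mulR D P) i
          ≡⟨ trans (at (mulR-distribʳ x (neg quo) P) i) (coeff-addR (mulR x P) _ i) ⟩
        coeff (mulR x P) i ⊕ coeff (mulR (neg quo) P) i
          ≡⟨ cong (_ ⊕_) (trans (at (mulR-negˡ quo P) i) (coeff-neg (mulR quo P) i)) ⟩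
        coeff (mulR x P) i ⊕ ⊝ coeff (mulR quo P) i
          ≡⟨ transpose _ _ _ _ (begin
               coeff (mulR x P) i ⊕ coeff s i       ≡⟨ sym (coeff-addR (mulR x P) s i) ⟩
               coeff (addR (mulR x P) s) i          ≡⟨ sym (at A≈xP+s i) ⟩
               coeff A i                            ≡⟨ at (proj₁ (division-identity A)) i ⟩
               coeff (addR (mulR quo P) re) i       ≡⟨ coeff-addR (mulR quo P) re i ⟩
               coeff (mulR quo P) i ⊕ coeff re i    ∎) ⟩
        coeff re i ⊕ ⊝ coeff s i ∎
      D≈0 : D ≈ []
      D≈0 = small-multiple D λ i ps≤i → begin
        coeff (mulR D P) i        ≡⟨ coeff-DP i ⟩
        coeff re i ⊕ ⊝ coeff s i  ≡⟨ cong₂ (λ u v → u ⊕ ⊝ v)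
                                       (short-bounded re (proj₂ (division-identity A)) i ps≤i)
                                       (short-bounded s s<P i ps≤i) ⟩
        0# ⊕ ⊝ 0#                 ≡⟨ -‿inverseʳ 0# ⟩
        0#                        ∎
      quot≡x : quo ≡ x
      quot≡x = ≈⇒≡ (quot-normal A) nx (mk≈ λ i → sym (x∙y⁻¹≈ε⇒x≈y _ _
        (trans (sym (trans (coeff-addR x (neg quo) i) (cong (_ ⊕_) (coeff-neg quo i)))) (at D≈0 i))))
      rem≡s : re ≡ s
      rem≡s = ≈⇒≡ (rem-normal A) ns (mk≈ λ i → x∙y⁻¹≈ε⇒x≈y _ _
        (trans (sym (coeff-DP i)) (at (mulR-zeroˡ D P D≈0) i)))

  ≈-same-length : ∀ a b → length a ≡ length b → a ≈ b → a ≡ b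
  ≈-same-length []       []       _   _   = refl
  ≈-same-length (x ∷ xs) (y ∷ ys) len a≈b =
    cong₂ _∷_ (at a≈b zero) (≈-same-length xs ys (ℕₚ.suc-injective len) (tail-≈ a≈b))

  pad : Pol → ℕ → Pol
  pad e n = e ++ replicate n 0#

  pad-≈ : ∀ e n → pad e n ≈ e
  pad-≈ []       zero    = ≈-refl
  pad-≈ []       (suc n) = zero-∷ (pad-≈ [] n)
  pad-≈ (x ∷ xs) n       = ∷-≈ refl (pad-≈ xs n)

  length-pad : ∀ e n → length (pad e n) ≡ length e + n
  length-pad e n = trans (Listₚ.length-++ e) (cong (length e +_) (Listₚ.length-replicate n))

  toC : Fin q → Carrier
  toC = Inverse.to enum

  fromC : Carrier → Fin q
  fromC = Inverse.from enum

  toC-injective : Injective _≡_ _≡_ toC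
  toC-injective {i} {j} eq = begin
    i                ≡⟨ sym (Inverse.strictlyInverseʳ enum i) ⟩
    fromC (toC i)    ≡⟨ cong fromC eq ⟩
    fromC (toC j)    ≡⟨ Inverse.strictlyInverseʳ enum j ⟩
    j                ∎

  lists : ∀ n → Fin (q ^ n) → Pol
  lists zero    k = []
  lists (suc n) k = toC (proj₁ (remQuot {q} (q ^ n) k)) ∷ lists n (proj₂ (remQuot {q} (q ^ n) k))

  length-lists : ∀ n k → length (lists n k) ≡ n
  length-lists zero    k = refl
  length-lists (suc n) k = cong suc (length-lists n _)

  lists-injective : ∀ n → Injective _≡_ _≡_ (lists n)
  lists-injective zero    {Fin.zero} {Fin.zero} _ = refl
  lists-injective (suc n) {k} {k′} eq = begin
    k                                  ≡⟨ sym (Finₚ.combine-remQuot {q} (q ^ n) k) ⟩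
    uncurry combine (remQuot (q ^ n) k)  ≡⟨ cong₂ combine
                                            (toC-injective (Listₚ.∷-injectiveˡ eq))
                                            (lists-injective n (Listₚ.∷-injectiveʳ eq)) ⟩
    uncurry combine (remQuot (q ^ n) k′) ≡⟨ Finₚ.combine-remQuot {q} (q ^ n) k′ ⟩
    k′                                 ∎

  lists-onto : ∀ n u → length u ≡ n → ∃[ k ] lists n k ≡ u
  lists-onto zero    []      _   = Fin.zero , refl
  lists-onto (suc n) (x ∷ u) len with lists-onto n u (ℕₚ.suc-injective len)
  ... | k , lists-k≡u = combine (fromC x) k , (begin
    lists (suc n) (combine (fromC x) k)
      ≡⟨ cong (λ z → toC (proj₁ z) ∷ lists n (proj₂ z)) (Finₚ.remQuot-combine {q} {q ^ n} (fromC x) k) ⟩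
    toC (fromC x) ∷ lists n k
      ≡⟨ cong₂ _∷_ (Inverse.strictlyInverseˡ enum x) lists-k≡u ⟩
    x ∷ u ∎)

  -- Division by Q (ByQ) is used to describe the children of a polynomial.
  module DigitExpansion (p : Carrier) (ps : Pol) (y : Carrier) (ys : Pol)
                        (nP : Normal (p ∷ ps)) (nQ : Normal (y ∷ ys))
                        (ys<ps : length ys < length ps) where
    open Division p ps nP
    module ByQ = Division y ys nQ

    Q : Pol
    Q = y ∷ ys

    open Digits P Q

    parent : Pol → Pol
    parent w = wSeq w 1

    parent-characterisation : ∀ v x s → Normal v → Normal x → Normal s → length s < length P →
                              mulR Q v ≈ addR (mulR x P) s → parent v ≡ x
    parent-characterisation v x s nv nx ns s<P Qv≈xP+s =
      trans (cong (λ z → quot (sub (mul Q z) (rem (mul Q z) P)) P) nv) quotient≡x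
      where
      Qv≈ : mul Q v ≈ addR (mulR x P) s
      Qv≈ = ≈-trans (strip-≈ (mulR Q v)) Qv≈xP+s
      rem≡s : rem (mul Q v) P ≡ s
      rem≡s = proj₂ (division-unique (mul Q v) x s nx ns s<P Qv≈)
      Qv-s≈xP : sub (mul Q v) s ≈ addR (mulR x P) []
      Qv-s≈xP = mk≈ λ i → begin
        coeff (sub (mul Q v) s) i                     ≡⟨ coeff-sub (mul Q v) s i ⟩
        coeff (mul Q v) i ⊕ ⊝ coeff s i               ≡⟨ move-right _ _ _ (trans (at Qv≈ i) (coeff-addR (mulR x P) s i)) ⟩
        coeff (mulR x P) i                            ≡⟨ sym (+-identityʳ _) ⟩
        coeff (mulR x P) i ⊕ 0#                       ≡⟨ sym (coeff-addR (mulR x P) [] i) ⟩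
        coeff (addR (mulR x P) []) i                  ∎
      quotient≡x : quot (sub (mul Q v) (rem (mul Q v) P)) P ≡ x
      quotient≡x rewrite rem≡s = proj₁ (division-unique _ x [] nx refl (s≤s z≤n) Qv-s≈xP)

    parent-identity : ∀ v → Normal v →
      mulR Q v ≈ addR (mulR (parent v) P) (digitOf v) × length (digitOf v) < length P
    parent-identity v nv =
      subst (λ z → mulR Q v ≈ addR (mulR z P) (digitOf v)) (sym parent≡quot) Qv≈ , proj₂ division
      where
      division : DivisionIdentity (mul Q v) (quot (mul Q v) P , rem (mul Q v) P)
      division = division-identity (mul Q v)
      Qv≈ : mulR Q v ≈ addR (mulR (quot (mul Q v) P) P) (rem (mul Q v) P)
      Qv≈ = ≈-trans (≈-sym (strip-≈ (mulR Q v))) (proj₁ division)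
      parent≡quot : parent v ≡ quot (mul Q v) P
      parent≡quot = parent-characterisation v _ _ nv (quot-normal (mul Q v)) (rem-normal (mul Q v))
                      (proj₂ division) Qv≈

    wSeq-normal : ∀ w i → Normal (wSeq w i)
    wSeq-normal w zero    = strip-normal w
    wSeq-normal w (suc i) = quot-normal (sub (mul Q (wSeq w i)) (digitOf (wSeq w i)))

    wSeq-parent : ∀ w i → wSeq w (suc i) ≡ wSeq (parent w) i
    wSeq-parent w zero    = sym (wSeq-normal w 1)
    wSeq-parent w (suc i) = cong (λ z → quot (sub (mul Q z) (digitOf z)) P) (wSeq-parent w i)

    digit-parent : ∀ w i → digit w (suc i) ≡ digit (parent w) i
    digit-parent w i = cong digitOf (wSeq-parent w i)

    digit-zero : digitOf [] ≡ []
    digit-zero rewrite strip-cong (mulR Q []) [] (mulR-zeroʳ Q) = refl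

    wSeq-zero : ∀ i → wSeq [] i ≡ []
    wSeq-zero zero = refl
    wSeq-zero (suc i) rewrite wSeq-zero i | strip-cong (mulR Q []) [] (mulR-zeroʳ Q) = refl

    -- d = deg P - deg Q; there are q^d children of every polynomial
    d : ℕ
    d = length ps ∸ length ys

    ys+d≡ps : length ys + d ≡ length ps
    ys+d≡ps = ℕₚ.m+[n∸m]≡n (ℕₚ.<⇒≤ ys<ps)

    Q·short-bounded : ∀ u → length u ≤ d → Bounded (mulR Q u) (length ps)
    Q·short-bounded []       _    = bounded-≈ (≈-sym (mulR-zeroʳ Q)) (λ _ _ → refl)
    Q·short-bounded (u ∷ us) u≤d  = bounded-mono (mulR Q (u ∷ us)) ys+us<ps (bounded-mulR y ys u us)
      where
      ys+us<ps : suc (length ys + length us) ≤ length ps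
      ys+us<ps = subst (_≤ length ps) (ℕₚ.+-suc (length ys) (length us))
                   (subst (length ys + suc (length us) ≤_) ys+d≡ps (ℕₚ.+-monoʳ-≤ (length ys) u≤d))

    Q·bounded-short : ∀ e → Normal e → Bounded (mulR Q e) (length ps) → length e ≤ d
    Q·bounded-short []       _  _   = z≤n
    Q·bounded-short (z ∷ zs) ne bnd =
      subst (_≤ d) (ℕₚ.m+n∸m≡n (length ys) (suc (length zs))) (ℕₚ.∸-monoˡ-≤ (length ys) ys+zs<ps)
      where
      ys+zs<ps : length ys + suc (length zs) ≤ length ps
      ys+zs<ps = subst (_≤ length ps) (sym (ℕₚ.+-suc (length ys) (length zs)))
        (nonzero-below-bound (mulR Q (z ∷ zs)) _ (length ps) (top-mulR-nonzero y ys z zs nQ ne) bnd)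

    -- The children of w (the v with parent v = w) are the polynomials
    -- v₀ + u with deg u < d, where  w·P = Q·v₀ + ρ  is division by Q.
    module Children (w : Pol) (nw : Normal w) where
      v₀ ρ : Pol
      v₀ = quot (mul w P) Q
      ρ  = rem (mul w P) Q

      coeff-wP : ∀ i → coeff (mulR w P) i ≡ coeff (mulR Q v₀) i ⊕ coeff ρ i
      coeff-wP i = begin
        coeff (mulR w P) i                 ≡⟨ sym (coeff-mul w P i) ⟩
        coeff (mul w P) i                  ≡⟨ at (proj₁ (ByQ.division-identity (mul w P))) i ⟩
        coeff (addR (mulR v₀ Q) ρ) i       ≡⟨ coeff-addR (mulR v₀ Q) ρ i ⟩
        coeff (mulR v₀ Q) i ⊕ coeff ρ i    ≡⟨ cong (_⊕ coeff ρ i) (at (mulR-comm v₀ Q) i) ⟩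
        coeff (mulR Q v₀) i ⊕ coeff ρ i    ∎

      ρ-bounded : Bounded ρ (length ps)
      ρ-bounded = bounded-mono ρ
        (ℕₚ.≤-trans (ℕₚ.≤-pred (proj₂ (ByQ.division-identity (mul w P)))) (ℕₚ.<⇒≤ ys<ps))
        (bounded-length ρ)

      child : Fin (q ^ d) → Pol
      child k = add v₀ (lists d k)

      child-normal : ∀ k → Normal (child k)
      child-normal k = strip-normal (addR v₀ (lists d k))

      -- Q·(v₀ + u) = w·P + (Q·u - ρ), and Q·u - ρ has degree < deg P
      child-parent : ∀ k → parent (child k) ≡ w
      child-parent k = parent-characterisation (child k) w s (child-normal k) nw
                         (strip-normal (addR (mulR Q u) (neg ρ))) s<P Q·child≈
        where
        u s : Pol
        u = lists d k
        s = add (mulR Q u) (neg ρ)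
        s<P : length s < length P
        s<P = s≤s (length-strip-bounded (addR (mulR Q u) (neg ρ)) (length ps)
                (bounded-addR (mulR Q u) (neg ρ) (Q·short-bounded u (ℕₚ.≤-reflexive (length-lists d k)))
                  (bounded-neg {ρ} ρ-bounded)))
        Q·child≈ : mulR Q (child k) ≈ addR (mulR w P) s
        Q·child≈ = mk≈ λ i → begin
          coeff (mulR Q (child k)) i                     ≡⟨ at (mulR-congʳ Q (strip-≈ (addR v₀ u))) i ⟩
          coeff (mulR Q (addR v₀ u)) i                   ≡⟨ trans (at (mulR-distribˡ Q v₀ u) i)
                                                                  (coeff-addR (mulR Q v₀) (mulR Q u) i) ⟩
          coeff (mulR Q v₀) i ⊕ coeff (mulR Q u) i       ≡⟨ regroup (coeff-wP i) ⟩
          coeff (mulR w P) i ⊕ (coeff (mulR Q u) i ⊕ ⊝ coeff ρ i)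
                                                          ≡⟨ cong (coeff (mulR w P) i ⊕_) (sym (coeff-sub (mulR Q u) ρ i)) ⟩
          coeff (mulR w P) i ⊕ coeff s i                 ≡⟨ sym (coeff-addR (mulR w P) s i) ⟩
          coeff (addR (mulR w P) s) i                    ∎

      child-injective : Injective _≡_ _≡_ child
      child-injective {k} {k′} eq = lists-injective d
        (≈-same-length _ _ (trans (length-lists d k) (sym (length-lists d k′)))
          (mk≈ λ i → +-cancelˡ (coeff v₀ i) _ _
            (trans (sym (coeff-add v₀ (lists d k) i))
              (trans (cong (λ z → coeff z i) eq) (coeff-add v₀ (lists d k′) i)))))

      -- if parent v = w then Q·(v - v₀) = s₀(v) + ρ has degree < deg P,
      -- so v - v₀ is one of the q^d lists of length d (after padding)
      child-onto : ∀ v → Normal v → parent v ≡ w → ∃[ k ] child k ≡ v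
      child-onto v nv parent≡w = k , ≈⇒≡ (child-normal k) nv (mk≈ λ i → begin
          coeff (add v₀ (lists d k)) i     ≡⟨ coeff-add v₀ (lists d k) i ⟩
          coeff v₀ i ⊕ coeff (lists d k) i ≡⟨ cong (λ z → coeff v₀ i ⊕ coeff z i) lists-k≡u ⟩
          coeff v₀ i ⊕ coeff u i           ≡⟨ cong (coeff v₀ i ⊕_) (trans (at (pad-≈ e (d ∸ length e)) i)
                                                                        (coeff-sub v v₀ i)) ⟩
          coeff v₀ i ⊕ (coeff v i ⊕ ⊝ coeff v₀ i) ≡⟨ add-sub-cancel _ _ ⟩
          coeff v i                        ∎)
        where
        S : Pol
        S = digitOf v
        coeff-Qv : ∀ i → coeff (mulR Q v) i ≡ coeff (mulR w P) i ⊕ coeff S i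
        coeff-Qv i = begin
          coeff (mulR Q v) i                        ≡⟨ at (proj₁ (parent-identity v nv)) i ⟩
          coeff (addR (mulR (parent v) P) S) i      ≡⟨ coeff-addR (mulR (parent v) P) S i ⟩
          coeff (mulR (parent v) P) i ⊕ coeff S i   ≡⟨ cong (λ z → coeff (mulR z P) i ⊕ coeff S i) parent≡w ⟩
          coeff (mulR w P) i ⊕ coeff S i            ∎
        e : Pol
        e = sub v v₀
        coeff-Qe : ∀ i → coeff (mulR Q e) i ≡ coeff S i ⊕ coeff ρ i
        coeff-Qe i = begin
          coeff (mulR Q e) i                                  ≡⟨ at (mulR-congʳ Q (strip-≈ (addR v (neg v₀)))) i ⟩
          coeff (mulR Q (addR v (neg v₀))) i                  ≡⟨ trans (at (mulR-distribˡ Q v (neg v₀)) i)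
                                                                       (coeff-addR (mulR Q v) (mulR Q (neg v₀)) i) ⟩
          coeff (mulR Q v) i ⊕ coeff (mulR Q (neg v₀)) i      ≡⟨ cong₂ _⊕_ (coeff-Qv i)
                                                                   (trans (at (mulR-negʳ Q v₀) i) (coeff-neg (mulR Q v₀) i)) ⟩
          (coeff (mulR w P) i ⊕ coeff S i) ⊕ ⊝ coeff (mulR Q v₀) i ≡⟨ cancel-common (coeff-wP i) ⟩
          coeff S i ⊕ coeff ρ i                               ∎
        e≤d : length e ≤ d
        e≤d = Q·bounded-short e (strip-normal (addR v (neg v₀))) λ i ps≤i → begin
          coeff (mulR Q e) i     ≡⟨ coeff-Qe i ⟩
          coeff S i ⊕ coeff ρ i  ≡⟨ cong₂ _⊕_ (short-bounded S (proj₂ (parent-identity v nv)) i ps≤i)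
                                              (ρ-bounded i ps≤i) ⟩
          0# ⊕ 0#                ≡⟨ +-identityʳ 0# ⟩
          0#                     ∎
        u : Pol
        u = pad e (d ∸ length e)
        k : Fin (q ^ d)
        k = proj₁ (lists-onto d u (trans (length-pad e _) (ℕₚ.m+[n∸m]≡n e≤d)))
        lists-k≡u : lists d k ≡ u
        lists-k≡u = proj₂ (lists-onto d u (trans (length-pad e _) (ℕₚ.m+[n∸m]≡n e≤d)))

    digitLength-unique : ∀ {w k k′} → DigitLength w k → DigitLength w k′ → k ≡ k′
    digitLength-unique (van , least) (van′ , least′) = ℕₚ.≤-antisym (least _ van′) (least′ _ van)

    digitLength-zero : ∀ w → parent w ≡ [] → DigitLength w 0
    digitLength-zero w parent≡0 =
      (λ { (suc i) _ → trans (wSeq-parent w i) (trans (cong (λ z → wSeq z i) parent≡0) (wSeq-zero i)) }) ,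
      (λ _ _ → z≤n)

    digitLength-parent : ∀ w {z : Carrier} {zs k} → parent w ≡ z ∷ zs →
                         DigitLength (z ∷ zs) k → DigitLength w (suc k)
    digitLength-parent w {z} {zs} {k} parent≡ (van , least) = van′ , least′
      where
      wSeq-shift : ∀ i → wSeq w (suc i) ≡ wSeq (z ∷ zs) i
      wSeq-shift i = trans (wSeq-parent w i) (cong (λ u → wSeq u i) parent≡)
      van′ : VanishesAfter w (suc k)
      van′ (suc i) (s≤s k<i) = trans (wSeq-shift i) (van i k<i)
      least′ : ∀ k′ → VanishesAfter w k′ → suc k ≤ k′
      least′ zero     van-w with () ← trans (sym parent≡) (van-w 1 (s≤s z≤n))
      least′ (suc k′) van-w = s≤s (least k′ λ i k′<i → trans (sym (wSeq-shift i)) (van-w (suc i) (s≤s k′<i)))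

    Compare : Pol → Pol → ℕ → ℕ → Set
    Compare w v k ℓ = k < ℓ ⊎ (k ≡ ℓ × ∃[ i ] (i ≤ k × digit w i ⊏ₚ digit v i ×
                        (∀ j → i < j → j ≤ k → digit w j ≡ digit v j)))

    compare-parent : ∀ w v k ℓ → Compare (parent w) (parent v) k ℓ → Compare w v (suc k) (suc ℓ)
    compare-parent w v k ℓ (inj₁ k<ℓ) = inj₁ (s≤s k<ℓ)
    compare-parent w v k ℓ (inj₂ (k≡ℓ , i , i≤k , less , same)) =
      inj₂ (cong suc k≡ℓ , suc i , s≤s i≤k ,
            subst₂ _⊏ₚ_ (sym (digit-parent w i)) (sym (digit-parent v i)) less ,
            λ { (suc j) (s≤s i<j) (s≤s j≤k) →
                  trans (digit-parent w j) (trans (same j i<j j≤k) (sym (digit-parent v j))) })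

    ⊏-asym : ∀ {w v} → w ⊏ v → v ⊏ w → ⊥
    ⊏-asym {w} {v} (k , ℓ , dw , dv , w<v) (ℓ′ , k′ , dv′ , dw′ , v<w)
      with digitLength-unique dw dw′ | digitLength-unique dv dv′
    ... | refl | refl with w<v | v<w
    ... | inj₁ k<ℓ | inj₁ ℓ<k = ℕₚ.<-asym k<ℓ ℓ<k
    ... | inj₁ k<ℓ | inj₂ (ℓ≡k , _) = ℕₚ.<-irrefl (sym ℓ≡k) k<ℓ
    ... | inj₂ (k≡ℓ , _) | inj₁ ℓ<k = ℕₚ.<-irrefl (sym k≡ℓ) ℓ<k
    ... | inj₂ (refl , i , i≤k , less , same) | inj₂ (_ , i′ , i′≤k , less′ , same′)
      with ℕₚ.<-cmp i i′
    ...   | tri< i<i′ _ _ = ℕₚ.<-irrefl refl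
                              (subst (λ z → polyIndex (digit v i′) < polyIndex z) (same i′ i<i′ i′≤k) less′)
    ...   | tri≈ _ refl _ = ℕₚ.<-asym less less′
    ...   | tri> _ _ i′<i = ℕₚ.<-irrefl refl
                              (subst (λ z → polyIndex (digit w i) < polyIndex z) (same′ i i′<i i≤k) less)

    ⊏-irrefl : ∀ {w} → w ⊏ w → ⊥
    ⊏-irrefl w⊏w = ⊏-asym w⊏w w⊏w

    -- 0 is the least element: its digit string is the single digit 0
    nothing-below-zero : ∀ {w} → w ⊏ [] → ⊥
    nothing-below-zero (k , ℓ , _ , d0 , w<0) with digitLength-unique d0 (digitLength-zero [] (wSeq-zero 1))
    nothing-below-zero (k , ℓ , _ , d0 , inj₁ ()) | refl
    nothing-below-zero {w} (k , ℓ , _ , d0 , inj₂ (refl , zero , _ , less , _)) | refl =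
      ℕₚ.n≮0 (subst (λ z → polyIndex (digit w 0) < polyIndex z) digit-zero less)

    ⊏-parent : ∀ w v → parent w ⊏ parent v → w ⊏ v
    ⊏-parent w v pw⊏pv with parent w in pw≡ | parent v in pv≡
    ... | []     | []     = ⊥-elim (⊏-irrefl pw⊏pv)
    ... | _ ∷ _  | []     = ⊥-elim (nothing-below-zero pw⊏pv)
    ... | []     | _ ∷ _  = let (_ , ℓ , _ , dv , _) = pw⊏pv in
      0 , suc ℓ , digitLength-zero w pw≡ , digitLength-parent v pv≡ dv , inj₁ (s≤s z≤n)
    ... | _ ∷ _  | _ ∷ _  = let (k , ℓ , dw , dv , w<v) = pw⊏pv in
      suc k , suc ℓ , digitLength-parent w pw≡ dw , digitLength-parent v pv≡ dv ,
      compare-parent w v k ℓ (subst₂ (λ a b → Compare a b k ℓ) (sym pw≡) (sym pv≡) w<v)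

    -- The
    -- parent map induces a monotone map on indices whose fibres have
    -- q^d elements, so by the counting lemma the parent of b(r·t + k)
    -- is b(t); iterating m times gives the m-th ancestor.
    module Enumeration (b : ℕ → Pol) (isEnum : IsDigitEnumeration b) where
      b-normal : ∀ n → Normal (b n)
      b-normal = proj₁ isEnum

      b-onto : ∀ w → Normal w → ∃[ n ] b n ≡ w
      b-onto = proj₁ (proj₂ isEnum)

      b-increasing : ∀ m n → m < n → b m ⊏ b n
      b-increasing = proj₂ (proj₂ isEnum)

      b-injective : Injective _≡_ _≡_ b
      b-injective {m} {n} bm≡bn with ℕₚ.<-cmp m n
      ... | tri< m<n _ _ = ⊥-elim (⊏-irrefl (subst (b m ⊏_) (sym bm≡bn) (b-increasing m n m<n)))
      ... | tri≈ _ m≡n _ = m≡n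
      ... | tri> _ _ n<m = ⊥-elim (⊏-irrefl (subst (b n ⊏_) bm≡bn (b-increasing n m n<m)))

      parentIndex : ℕ → ℕ
      parentIndex n = proj₁ (b-onto (parent (b n)) (wSeq-normal (b n) 1))

      b-parentIndex : ∀ n → b (parentIndex n) ≡ parent (b n)
      b-parentIndex n = proj₂ (b-onto (parent (b n)) (wSeq-normal (b n) 1))

      parentIndex-mono : ∀ {m n} → m ≤ n → parentIndex m ≤ parentIndex n
      parentIndex-mono {m} {n} m≤n with ℕₚ.m≤n⇒m<n∨m≡n m≤n
      ... | inj₂ refl = ℕₚ.≤-refl
      ... | inj₁ m<n with parentIndex m ≤? parentIndex n
      ...   | yes ≤ = ≤
      ...   | no  ≰ = ⊥-elim (⊏-asym (b-increasing m n m<n)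
                        (⊏-parent (b n) (b m) (subst₂ _⊏_ (b-parentIndex n) (b-parentIndex m)
                          (b-increasing _ _ (ℕₚ.≰⇒> ≰)))))

      r : ℕ
      r = q ^ d

      module ChildrenOf (t : ℕ) = Children (b t) (b-normal t)

      childIndex : ℕ → Fin r → ℕ
      childIndex t k = proj₁ (b-onto (ChildrenOf.child t k) (ChildrenOf.child-normal t k))

      b-childIndex : ∀ t k → b (childIndex t k) ≡ ChildrenOf.child t k
      b-childIndex t k = proj₂ (b-onto (ChildrenOf.child t k) (ChildrenOf.child-normal t k))

      childIndex-parent : ∀ t k → parentIndex (childIndex t k) ≡ t
      childIndex-parent t k = b-injective (begin
        b (parentIndex (childIndex t k))    ≡⟨ b-parentIndex (childIndex t k) ⟩
        parent (b (childIndex t k))         ≡⟨ cong parent (b-childIndex t k) ⟩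
        parent (ChildrenOf.child t k)       ≡⟨ ChildrenOf.child-parent t k ⟩
        b t                                 ∎)

      childIndex-injective : ∀ t → Injective _≡_ _≡_ (childIndex t)
      childIndex-injective t {k} {k′} eq = ChildrenOf.child-injective t
        (trans (sym (b-childIndex t k)) (trans (cong b eq) (b-childIndex t k′)))

      childIndex-onto : ∀ t n → parentIndex n ≡ t → ∃[ k ] childIndex t k ≡ n
      childIndex-onto t n parentIndex≡t = k , b-injective (trans (b-childIndex t k) child-k≡bn)
        where
        parent≡ : parent (b n) ≡ b t
        parent≡ = trans (sym (b-parentIndex n)) (cong b parentIndex≡t)
        onto : ∃[ k ] ChildrenOf.child t k ≡ b n
        onto = ChildrenOf.child-onto t (b n) (b-normal n) parent≡
        k : Fin r
        k = proj₁ onto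
        child-k≡bn : ChildrenOf.child t k ≡ b n
        child-k≡bn = proj₂ onto

      open MonotoneFibres r parentIndex parentIndex-mono childIndex childIndex-parent
                          childIndex-injective childIndex-onto
        using (fibre-block)

      parent-block : ∀ t k → k < r → parent (b (r * t + k)) ≡ b t
      parent-block t k k<r = trans (sym (b-parentIndex _)) (cong b (fibre-block t k k<r))

      instance
        r-nonZero : NonZero r
        r-nonZero = ℕₚ.m^n≢0 q d

      split-index : ∀ m t k → r ^ suc m * t + k ≡ r * (r ^ m * t + k / r) + k % r
      split-index m t k = begin
        r ^ suc m * t + k                   ≡⟨ cong (r ^ suc m * t +_) (DivModₚ.m≡m%n+[m/n]*n k r) ⟩
        r ^ suc m * t + (k % r + k / r * r) ≡⟨ rearrange r (r ^ m) t (k / r) (k % r) ⟩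
        r * (r ^ m * t + k / r) + k % r     ∎
        where
        open +-*-Solver
        rearrange : ∀ r a t k′ k″ → r * a * t + (k″ + k′ * r) ≡ r * (a * t + k′) + k″
        rearrange = solve 5 (λ r a t k′ k″ →
          r :* a :* t :+ (k″ :+ k′ :* r) := r :* (a :* t :+ k′) :+ k″) refl

      ancestor : ∀ m t k → k < r ^ m → wSeq (b (r ^ m * t + k)) m ≡ b t
      ancestor zero    t zero    _ = begin
        strip (b (1 * t + 0))   ≡⟨ cong (λ n → strip (b n)) (trans (ℕₚ.+-identityʳ _) (ℕₚ.*-identityˡ t)) ⟩
        strip (b t)             ≡⟨ b-normal t ⟩
        b t                     ∎
      ancestor zero    t (suc k) (s≤s ())
      ancestor (suc m) t k k<r^1+m = begin
        wSeq (b (r ^ suc m * t + k)) (suc m)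
          ≡⟨ cong (λ n → wSeq (b n) (suc m)) (split-index m t k) ⟩
        wSeq (b (r * (r ^ m * t + k / r) + k % r)) (suc m)
          ≡⟨ wSeq-parent _ m ⟩
        wSeq (parent (b (r * (r ^ m * t + k / r) + k % r))) m
          ≡⟨ cong (λ w → wSeq w m) (parent-block _ (k % r) (DivModₚ.m%n<n k r)) ⟩
        wSeq (b (r ^ m * t + k / r)) m
          ≡⟨ ancestor m t (k / r) k/r<r^m ⟩
        b t ∎
        where
        k/r<r^m : k / r < r ^ m
        k/r<r^m = DivModₚ.m<n*o⇒m/o<n (subst (k <_) (ℕₚ.*-comm r (r ^ m)) k<r^1+m)

      digit-block : ∀ t m k → k < r ^ m → sdig m (b (r ^ m * t + k)) ≡ sdig 0 (b t)
      digit-block t m k k<r^m = begin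
        digitOf (wSeq (b (r ^ m * t + k)) m)   ≡⟨ cong digitOf (ancestor m t k k<r^m) ⟩
        digitOf (b t)                          ≡⟨ cong digitOf (sym (b-normal t)) ⟩
        digitOf (strip (b t))                  ∎

-- Writing P = p + ps·X and Q = y + ys·X, the hypotheses
-- Q ≠ 0 and deg Q < deg P become length ys < length ps, and r = q^d.
lemma4p8 : (𝔽 : FiniteField) → let open Poly 𝔽 in
    (P Q : Pol) → Normal P → Normal Q → 0 < length Q → length Q < length P →
    Coprime P Q →
    let open Digits P Q in let r = FiniteField.q 𝔽 ^ (length P ∸ length Q) in
    (b : ℕ → Pol) → IsDigitEnumeration b →
    ∀ t m k → k < r ^ m → sdig m (b (r ^ m * t + k)) ≡ sdig 0 (b t)
lemma4p8 𝔽 []       Q        _  _  _  ()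
lemma4p8 𝔽 (p ∷ ps) []       _  _  () _
lemma4p8 𝔽 (p ∷ ps) (y ∷ ys) nP nQ _  (s≤s ys<ps) _ b isEnum =
  Enumeration.digit-block b isEnum
  where open Polynomials.DigitExpansion 𝔽 p ps y ys nP nQ ys<ps
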